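{- Let $P,Q$ be finite posets with $|P|=p$, $|Q|=q$, let $D_\lambda\in\mathfrak{D}_n$, let $R=P\oplus D_\lambda\oplus Q$, let $f$ be a linear extension of $R$, and let $1\le k\le p+n+q$. Then: (1) if $k-1\le p$, then $I(q_{k-1}(f))=I(f)$; (2) if $p<k-1<p+n$, then $I(q_{k-1}(f))=q_{k-1-p}(I(f))$; (3) if $p+n\le k-1$, then $I(q_{k-1}(f))=q_{n-1}\partial_n^{\,k-p-n}(I(f))$, where on the right-hand sides $q_{k-1-p}$, $q_{n-1}$, $\partial_n$ are the operators on linear extensions of $D_\lambda$.
   Context: For a finite poset $X$ with $|X|=N$, a linear extension is a bijection $f:X\to\{1,\ldots,N\}$ with $f(a)<f(b)$ whenever $a<_X b$. For $1\le i\le N-1$ the Bender–Knuth involution $t_i$ swaps labels $i$ and $i+1$ if $f^{ -1}(i)$, $f^{ -1}(i+1)$ are incomparable, and does nothing otherwise. Products denote composition, rightmost first. $\partial_1=\mathrm{id}$, $\partial_k=t_{k-1}\cdots t_1$; $q_0=\mathrm{id}$, $q_i=t_1(t_2t_1)\cdots(t_it_{i-1}\cdots t_1)$. $X\oplus Y$: ordinal sum (all of $X$ below all of $Y$); $+$: disjoint union; $C_m$: $m$-element chain. For $n>1$, $\mathfrak{D}_n$ is the set of posets $C_{\lambda_1}+\cdots+C_{\lambda_\ell}$ with $\lambda\vdash n$, $\ell>1$; $\mathfrak{D}_1=\{C_1\}$. For a linear extension $f$ of $R=P\oplus D_\lambda\oplus Q$ one has $f(D_\lambda)=\{p+1,\ldots,p+n\}$;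 the induced linear extension $I(f)$ of $D_\lambda$ is $I(f)(x)=f(x)-p$ for $x\in D_\lambda$. -}

module Defs where

open import Data.Nat as ℕ using (ℕ; zero; suc; _+_; _∸_; _≥_)
open import Data.Fin as Fin using (Fin; splitAt; _↑ˡ_; _↑ʳ_)
open import Data.Fin.Properties as FinP using (any?)
open import Data.Sum using (_⊎_; inj₁; inj₂)
open import Data.Sum.Relation.Unary.All using ()
open import Data.Product using (Σ; ∃; _×_; _,_)
open import Data.Unit using (⊤; tt)
open import Data.Empty using (⊥)
open import Data.List using (List; []; _∷_; length)
open import Data.Nat.ListAction using (sum)
open import Data.List.Relation.Unary.All using (All)
open import Data.List.Relation.Unary.Linked using (Linked)
open import Relation.Nullary using (¬_; Dec; yes; no)
open import Relation.Nullary.Decidable using (_×-dec_; _⊎-dec_)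
open import Relation.Binary.PropositionalEquality using (_≡_; refl)

record FinPoset : Set₁ where
  field
    size     : ℕ
    _≺_      : Fin size → Fin size → Set
    ≺-dec    : ∀ x y → Dec (x ≺ y)
    ≺-irrefl : ∀ x → ¬ (x ≺ x)
    ≺-trans  : ∀ {x y z} → x ≺ y → y ≺ z → x ≺ z

open FinPoset public

-- Generic relation on a sum of two carriers; `cross` decides whether
-- every left element lies below every right element (ordinal sum)
-- or nothing is related across (disjoint union).

module _ {A B : Set} (_<A_ : A → A → Set) (_<B_ : B → B → Set) (cross : Set) where
  SumRel : A ⊎ B → A ⊎ B → Set
  SumRel (inj₁ a) (inj₁ a′) = a <A a′
  SumRel (inj₁ a) (inj₂ b)  = cross
  SumRel (inj₂ b) (inj₁ a)  = ⊥
  SumRel (inj₂ b) (inj₂ b′) = b <B b′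

  SumRel-dec : (∀ x y → Dec (x <A y)) → (∀ x y → Dec (x <B y)) → Dec cross →
               ∀ u v → Dec (SumRel u v)
  SumRel-dec dA dB dc (inj₁ a) (inj₁ a′) = dA a a′
  SumRel-dec dA dB dc (inj₁ a) (inj₂ b)  = dc
  SumRel-dec dA dB dc (inj₂ b) (inj₁ a)  = no (λ ())
  SumRel-dec dA dB dc (inj₂ b) (inj₂ b′) = dB b b′

  SumRel-irrefl : (∀ x → ¬ (x <A x)) → (∀ x → ¬ (x <B x)) → ∀ u → ¬ SumRel u u
  SumRel-irrefl iA iB (inj₁ a) = iA a
  SumRel-irrefl iA iB (inj₂ b) = iB b

  SumRel-trans : (∀ {x y z} → x <A y → y <A z → x <A z) →
                 (∀ {x y z} → x <B y → y <B z → x <B z) →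
                 ∀ u v w → SumRel u v → SumRel v w → SumRel u w
  SumRel-trans tA tB (inj₁ a) (inj₁ b) (inj₁ c) p q = tA p q
  SumRel-trans tA tB (inj₁ a) (inj₁ b) (inj₂ c) p q = q
  SumRel-trans tA tB (inj₁ a) (inj₂ b) (inj₂ c) p q = p
  SumRel-trans tA tB (inj₂ a) (inj₂ b) (inj₂ c) p q = tB p q
  SumRel-trans tA tB (inj₁ a) (inj₂ b) (inj₁ c) p ()
  SumRel-trans tA tB (inj₂ a) (inj₁ b) w () q
  SumRel-trans tA tB (inj₂ a) (inj₂ b) (inj₁ c) p ()

combine : (X Y : FinPoset) (cross : Set) → Dec cross → FinPoset
combine X Y cross dc = record
  { size     = size X + size Y
  ; _≺_      = λ u v → Rel (splitAt (size X) u) (splitAt (size X) v)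
  ; ≺-dec    = λ u v → SumRel-dec (_≺_ X) (_≺_ Y) cross (≺-dec X) (≺-dec Y) dc
                          (splitAt (size X) u) (splitAt (size X) v)
  ; ≺-irrefl = λ u → SumRel-irrefl (_≺_ X) (_≺_ Y) cross (≺-irrefl X) (≺-irrefl Y)
                          (splitAt (size X) u)
  ; ≺-trans  = λ {u} {v} {w} → SumRel-trans (_≺_ X) (_≺_ Y) cross (≺-trans X) (≺-trans Y)
                          (splitAt (size X) u) (splitAt (size X) v) (splitAt (size X) w)
  }
  where Rel = SumRel (_≺_ X) (_≺_ Y) cross

infixr 6 _⊕_
_⊕_ : FinPoset → FinPoset → FinPoset
X ⊕ Y = combine X Y ⊤ (yes tt)

infixr 6 _⊞_
_⊞_ : FinPoset → FinPoset → FinPoset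
X ⊞ Y = combine X Y ⊥ (no (λ ()))

Chain : ℕ → FinPoset
Chain m = record
  { size = m ; _≺_ = Fin._<_ ; ≺-dec = Fin._<?_
  ; ≺-irrefl = λ x → FinP.<-irrefl refl ; ≺-trans = FinP.<-trans }

-- D_λ = C_{λ₁} + ⋯ + C_{λ_ℓ}  (ending in the empty poset C_0, which is
-- harmless: X + ∅ ≅ X).  Its size is λ₁ + ⋯ + λ_ℓ = sum λ.
Dλ : List ℕ → FinPoset
Dλ []      = Chain 0
Dλ (m ∷ ms) = Chain m ⊞ Dλ ms

IsPartitionOf : ℕ → List ℕ → Set
IsPartitionOf n ms = All (λ m → 1 ℕ.≤ m) ms × Linked _≥_ ms × sum ms ≡ n

InFrakD : ℕ → List ℕ → Set
InFrakD n ms = (1 ℕ.< n × IsPartitionOf n ms × 1 ℕ.< length ms)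
            ⊎ (n ≡ 1 × ms ≡ 1 ∷ [])

record LinExt (X : FinPoset) : Set where
  field
    lab   : Fin (size X) → ℕ
    range : ∀ x → 1 ℕ.≤ lab x × lab x ℕ.≤ size X
    inj   : ∀ x y → lab x ≡ lab y → x ≡ y
    surj  : ∀ i → 1 ℕ.≤ i → i ℕ.≤ size X → ∃ λ x → lab x ≡ i
    mono  : ∀ {x y} → _≺_ X x y → lab x ℕ.< lab y

open LinExt public

-- labellings (the operators act on these; on linear extensions they are
-- the operators of the paper)
Labelling : FinPoset → Set
Labelling X = Fin (size X) → ℕ

Comparable : (X : FinPoset) → Fin (size X) → Fin (size X) → Set
Comparable X x y = _≺_ X x y ⊎ _≺_ X y x

Blocked : (X : FinPoset) → ℕ → Labelling X → Set
Blocked X i f = ∃ λ x → ∃ λ y → f x ≡ i × f y ≡ suc i × Comparable X x y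

Blocked? : (X : FinPoset) (i : ℕ) (f : Labelling X) → Dec (Blocked X i f)
Blocked? X i f = any? λ x → any? λ y →
  (f x ℕ.≟ i) ×-dec ((f y ℕ.≟ suc i) ×-dec (≺-dec X x y ⊎-dec ≺-dec X y x))

swapLab : ℕ → ℕ → ℕ
swapLab i m with m ℕ.≟ i
... | yes _ = suc i
... | no _ with m ℕ.≟ suc i
...   | yes _ = i
...   | no _  = m

t : (X : FinPoset) → ℕ → Labelling X → Labelling X
t X i f with Blocked? X i f
... | yes _ = f
... | no _  = λ x → swapLab i (f x)

tDown : (X : FinPoset) → ℕ → Labelling X → Labelling X
tDown X zero    f = f
tDown X (suc k) f = t X (suc k) (tDown X k f)

∂ : (X : FinPoset) → ℕ → Labelling X → Labelling X
∂ X k = tDown X (k ∸ 1)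

-- q_0 = id, q_i = t_1 (t_2 t_1) ⋯ (t_i ⋯ t_1) = q_{i-1} ∘ (t_i ⋯ t_1)
q : (X : FinPoset) → ℕ → Labelling X → Labelling X
q X zero    f = f
q X (suc i) f = q X i (tDown X (suc i) f)

iter : ∀ {A : Set} → ℕ → (A → A) → A → A
iter zero    g a = a
iter (suc m) g a = g (iter m g a)

I : (P D Q : FinPoset) → Labelling (P ⊕ (D ⊕ Q)) → Labelling D
I P D Q f x = f (size P ↑ʳ (x ↑ˡ size Q)) ∸ size P

-- In a linear extension of P ⊕ D ⊕ Q the blocks P, D, Q carry the consecutive label
-- intervals [1, p], [p+1, p+d] and [p+d+1, N].  The labels p, p+1 (and p+d, p+d+1)
-- then sit on comparable elements, so t_p and t_{p+d} are trivial and every t_i keeps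
-- each block on its interval: for p < i < p+d it acts on D as t_{i−p}, otherwise it
-- does not move the labels of D.  Hence t_j ⋯ t_1 induces t_{clip j} ⋯ t_1 on D with
-- clip j = min (j − p) (d − 1), and composing these along q_m gives the three cases.
module Submission where

open import Defs
open import Data.Nat using (ℕ; zero; suc; _+_; _∸_; _≤_; _<_; _⊓_; _≤?_; z≤n; s≤s; s≤s⁻¹)
open import Data.Nat.Properties
open import Data.Nat.ListAction using (sum)
open import Data.Fin using (Fin; splitAt; _↑ˡ_; _↑ʳ_; toℕ; fromℕ<)
open import Data.Fin.Properties using (↑ˡ-injective; ↑ʳ-injective; splitAt-↑ˡ; splitAt-↑ʳ; splitAt⁻¹-↑ˡ; splitAt⁻¹-↑ʳ; injective⇒≤; toℕ-fromℕ<)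
open import Data.List using (List; []; _∷_)
open import Data.Product using (∃; _×_; _,_; proj₁; proj₂)
open import Data.Sum using (_⊎_; inj₁; inj₂; [_,_])
open import Data.Empty using (⊥-elim)
open import Data.Unit using (tt)
open import Relation.Nullary using (¬_; yes; no)
open import Relation.Binary.PropositionalEquality
  using (_≡_; _≢_; _≗_; refl; sym; trans; cong; cong₂; cong-app; subst; ≢-sym; module ≡-Reasoning)
open import Function using (_∘_; id)

swapLab-i : ∀ i → swapLab i i ≡ suc i
swapLab-i i with i ≟ i
... | yes _   = refl
... | no i≢i  = ⊥-elim (i≢i refl)

swapLab-suc-i : ∀ i → swapLab i (suc i) ≡ i
swapLab-suc-i i with suc i ≟ i
... | yes 1+i≡i = ⊥-elim (1+n≢n 1+i≡i)
... | no _ with suc i ≟ suc i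
...   | yes _  = refl
...   | no ≢   = ⊥-elim (≢ refl)

swapLab-other : ∀ i m → m ≢ i → m ≢ suc i → swapLab i m ≡ m
swapLab-other i m m≢i m≢1+i with m ≟ i
... | yes m≡i = ⊥-elim (m≢i m≡i)
... | no _ with m ≟ suc i
...   | yes m≡1+i = ⊥-elim (m≢1+i m≡1+i)
...   | no _      = refl

data SwapCase (i m : ℕ) : Set where
  at-i     : m ≡ i → SwapCase i m
  at-suc-i : m ≡ suc i → SwapCase i m
  elsewhere : m ≢ i → m ≢ suc i → SwapCase i m

swapCase : ∀ i m → SwapCase i m
swapCase i m with m ≟ i | m ≟ suc i
... | yes m≡i | _         = at-i m≡i
... | no _    | yes m≡1+i = at-suc-i m≡1+i
... | no m≢i  | no m≢1+i  = elsewhere m≢i m≢1+i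

swapLab-involutive : ∀ i m → swapLab i (swapLab i m) ≡ m
swapLab-involutive i m with swapCase i m
... | at-i refl rewrite swapLab-i i = swapLab-suc-i i
... | at-suc-i refl rewrite swapLab-suc-i i = swapLab-i i
... | elsewhere m≢i m≢1+i rewrite swapLab-other i m m≢i m≢1+i = swapLab-other i m m≢i m≢1+i

swapLab-≤ : ∀ {i m b} → m ≤ b → i ≢ b → swapLab i m ≤ b
swapLab-≤ {i} {m} m≤b i≢b with swapCase i m
... | at-i refl rewrite swapLab-i i = ≤∧≢⇒< m≤b i≢b
... | at-suc-i refl rewrite swapLab-suc-i i = ≤-trans (n≤1+n i) m≤b
... | elsewhere m≢i m≢1+i rewrite swapLab-other i m m≢i m≢1+i = m≤b

<-swapLab : ∀ {i m a} → a < m → i ≢ a → a < swapLab i m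
<-swapLab {i} {m} a<m i≢a with swapCase i m
... | at-i refl rewrite swapLab-i i = ≤-trans a<m (n≤1+n i)
... | at-suc-i refl rewrite swapLab-suc-i i = ≤∧≢⇒< (s≤s⁻¹ a<m) (≢-sym i≢a)
... | elsewhere m≢i m≢1+i rewrite swapLab-other i m m≢i m≢1+i = a<m

swapLab-+ : ∀ p a b → swapLab (p + a) (p + b) ≡ p + swapLab a b
swapLab-+ p a b with swapCase a b
... | at-i refl rewrite swapLab-i a | swapLab-i (p + a) = sym (+-suc p a)
... | at-suc-i refl rewrite swapLab-suc-i a =
  trans (cong (swapLab (p + a)) (+-suc p a)) (swapLab-suc-i (p + a))
... | elsewhere b≢a b≢1+a rewrite swapLab-other a b b≢a b≢1+a =
  swapLab-other (p + a) (p + b) (b≢a ∘ +-cancelˡ-≡ p b a)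
    (λ e → b≢1+a (+-cancelˡ-≡ p b (suc a) (trans e (sym (+-suc p a)))))


swapLab-∸ : ∀ {p i m} → p ≤ i → p ≤ m → swapLab i m ∸ p ≡ swapLab (i ∸ p) (m ∸ p)
swapLab-∸ {p} {i} {m} p≤i p≤m = begin
  swapLab i m ∸ p
    ≡⟨ cong₂ (λ a b → swapLab a b ∸ p) (sym (m+[n∸m]≡n p≤i)) (sym (m+[n∸m]≡n p≤m)) ⟩
  swapLab (p + (i ∸ p)) (p + (m ∸ p)) ∸ p
    ≡⟨ cong (_∸ p) (swapLab-+ p (i ∸ p) (m ∸ p)) ⟩
  p + swapLab (i ∸ p) (m ∸ p) ∸ p
    ≡⟨ m+n∸m≡n p _ ⟩
  swapLab (i ∸ p) (m ∸ p) ∎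
  where open ≡-Reasoning

module _ (X : FinPoset) where

  t-elim : (Pr : Labelling X → Set) (i : ℕ) (f : Labelling X) →
           (Blocked X i f → Pr f) → (¬ Blocked X i f → Pr (λ x → swapLab i (f x))) → Pr (t X i f)
  t-elim Pr i f if-blocked if-free with Blocked? X i f
  ... | yes b = if-blocked b
  ... | no nb = if-free nb

  t-blocked : ∀ i f → Blocked X i f → t X i f ≡ f
  t-blocked i f b = t-elim (_≡ f) i f (λ _ → refl) (λ nb → ⊥-elim (nb b))

  t-unblocked : ∀ i f → ¬ Blocked X i f → t X i f ≡ (λ x → swapLab i (f x))
  t-unblocked i f nb = t-elim (_≡ (λ x → swapLab i (f x))) i f (λ b → ⊥-elim (nb b)) (λ _ → refl)

  Blocked-cong : ∀ i {f g} → f ≗ g → Blocked X i f → Blocked X i g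
  Blocked-cong i f≗g (x , y , fx , fy , c) = x , y , trans (sym (f≗g x)) fx , trans (sym (f≗g y)) fy , c

  t-cong : ∀ i {f g} → f ≗ g → t X i f ≗ t X i g
  t-cong i {f} {g} f≗g x with Blocked? X i f | Blocked? X i g
  ... | yes _ | yes _ = f≗g x
  ... | no _  | no _  = cong (swapLab i) (f≗g x)
  ... | yes b | no nb = ⊥-elim (nb (Blocked-cong i f≗g b))
  ... | no nb | yes b = ⊥-elim (nb (Blocked-cong i (sym ∘ f≗g) b))

  tDown-cong : ∀ j {f g} → f ≗ g → tDown X j f ≗ tDown X j g
  tDown-cong zero    f≗g = f≗g
  tDown-cong (suc j) f≗g = t-cong (suc j) (tDown-cong j f≗g)

iter-comm : ∀ {A : Set} m (g : A → A) a → iter m g (g a) ≡ g (iter m g a)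
iter-comm zero    g a = refl
iter-comm (suc m) g a = cong g (iter-comm m g a)

distinct-in-interval : ∀ {k lo hi} (h : Fin k → ℕ) → (∀ w v → h w ≡ h v → w ≡ v) →
                       (∀ w → lo ≤ h w × h w < hi) → lo ≤ hi → k + lo ≤ hi
distinct-in-interval {k} {lo} {hi} h h-injective h-bounds lo≤hi =
  m≤o∸n⇒m+n≤o k lo≤hi (injective⇒≤ shift-injective)
  where
  shift : Fin k → Fin (hi ∸ lo)
  shift w = fromℕ< (∸-monoˡ-< (proj₂ (h-bounds w)) (proj₁ (h-bounds w)))
  shift-injective : ∀ {w v} → shift w ≡ shift v → w ≡ v
  shift-injective {w} {v} e = h-injective w v (∸-cancelʳ-≡ (proj₁ (h-bounds w)) (proj₁ (h-bounds v))
    (trans (sym (toℕ-fromℕ< _)) (trans (cong toℕ e) (toℕ-fromℕ< _))))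

cancel-above : ∀ {x y k} → k + suc x ≤ suc (y + k) → x ≤ y
cancel-above {x} {y} {k} le =
  +-cancelˡ-≤ k x y (subst (k + x ≤_) (+-comm y k) (s≤s⁻¹ (subst (_≤ suc (y + k)) (+-suc k x) le)))

module OrdinalSum (P D Q : FinPoset) (d≥1 : 1 ≤ size D) where

  p d r : ℕ
  p = size P
  d = size D
  r = size Q

  R : FinPoset
  R = P ⊕ (D ⊕ Q)

  N : ℕ
  N = size R

  embP : Fin p → Fin N
  embP a = a ↑ˡ (d + r)

  embD : Fin d → Fin N
  embD x = p ↑ʳ (x ↑ˡ r)

  embQ : Fin r → Fin N
  embQ z = p ↑ʳ (d ↑ʳ z)

  IR : Labelling R → Labelling D
  IR = I P D Q

  p<p+d : p < p + d
  p<p+d = subst (_≤ p + d) (+-comm p 1) (+-monoʳ-≤ p d≥1)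

  p+d≤N : p + d ≤ N
  p+d≤N = +-monoʳ-≤ p (m≤m+n d r)

  P≺DQ : ∀ a w → _≺_ R (embP a) (p ↑ʳ w)
  P≺DQ a w rewrite splitAt-↑ˡ p a (d + r) | splitAt-↑ʳ p (d + r) w = tt

  D≺Q : ∀ x z → _≺_ R (embD x) (embQ z)
  D≺Q x z rewrite splitAt-↑ʳ p (d + r) (x ↑ˡ r) | splitAt-↑ʳ p (d + r) (d ↑ʳ z)
                | splitAt-↑ˡ d x r | splitAt-↑ʳ d r z = tt

  embD-comparable : ∀ x y → Comparable R (embD x) (embD y) ≡ Comparable D x y
  embD-comparable x y rewrite splitAt-↑ʳ p (d + r) (x ↑ˡ r) | splitAt-↑ʳ p (d + r) (y ↑ˡ r)
                            | splitAt-↑ˡ d x r | splitAt-↑ˡ d y r = refl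

  data Block (u : Fin N) : Set where
    inP : ∀ a → u ≡ embP a → Block u
    inD : ∀ x → u ≡ embD x → Block u
    inQ : ∀ z → u ≡ embQ z → Block u

  block : ∀ u → Block u
  block u with splitAt p u in eq
  ... | inj₁ a = inP a (sym (splitAt⁻¹-↑ˡ eq))
  ... | inj₂ w with splitAt d w in eq′
  ...   | inj₁ x = inD x (sym (trans (cong (p ↑ʳ_) (splitAt⁻¹-↑ˡ eq′)) (splitAt⁻¹-↑ʳ eq)))
  ...   | inj₂ z = inQ z (sym (trans (cong (p ↑ʳ_) (splitAt⁻¹-↑ʳ eq′)) (splitAt⁻¹-↑ʳ eq)))

  -- The invariant carried along the t-orbit of a linear extension.
  record Layered (g : Labelling R) : Set where
    field
      P-low  : ∀ a → g (embP a) ≤ p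
      D-low  : ∀ x → p < g (embD x)
      D-high : ∀ x → g (embD x) ≤ p + d
      Q-high : ∀ z → p + d < g (embQ z)
      onto   : ∀ j → 1 ≤ j → j ≤ N → ∃ λ u → g u ≡ j
  open Layered

  linExt-Layered : (f : LinExt R) → Layered (lab f)
  linExt-Layered f = record
    { P-low = P-low′ ; D-low = D-low′ ; D-high = D-high′ ; Q-high = Q-high′ ; onto = surj f }
    where
    g = lab f
    injective-on : ∀ {k} (e : Fin k → Fin N) → (∀ w v → e w ≡ e v → w ≡ v) →
                   ∀ w v → g (e w) ≡ g (e v) → w ≡ v
    injective-on e e-inj w v = e-inj w v ∘ inj f (e w) (e v)
    P-low′ : ∀ a → g (embP a) ≤ p
    P-low′ a = cancel-above (distinct-in-interval (g ∘ (p ↑ʳ_))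
      (injective-on (p ↑ʳ_) (↑ʳ-injective p))
      (λ w → mono f (P≺DQ a w) , s≤s (proj₂ (range f (p ↑ʳ w))))
      (s≤s (proj₂ (range f (embP a)))))
    D-low′ : ∀ x → p < g (embD x)
    D-low′ x = subst (_≤ g (embD x)) (+-comm p 1) (distinct-in-interval (g ∘ embP)
      (injective-on embP (↑ˡ-injective (d + r)))
      (λ a → proj₁ (range f (embP a)) , mono f (P≺DQ a (x ↑ˡ r)))
      (proj₁ (range f (embD x))))
    D-high′ : ∀ x → g (embD x) ≤ p + d
    D-high′ x = cancel-above (subst (λ n → r + suc (g (embD x)) ≤ suc n) (sym (+-assoc p d r))
      (distinct-in-interval (g ∘ embQ)
        (injective-on embQ (λ w v → ↑ʳ-injective d w v ∘ ↑ʳ-injective p _ _))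
        (λ z → mono f (D≺Q x z) , s≤s (proj₂ (range f (embQ z))))
        (s≤s (proj₂ (range f (embD x))))))
    Q-high′ : ∀ z → p + d < g (embQ z)
    Q-high′ z = subst (_≤ g (embQ z)) (trans (+-suc d p) (cong suc (+-comm d p)))
      (distinct-in-interval (g ∘ embD)
        (injective-on embD (λ w v → ↑ˡ-injective r w v ∘ ↑ʳ-injective p _ _))
        (λ x → D-low′ x , mono f (D≺Q x z))
        (<-trans (D-low′ x₀) (mono f (D≺Q x₀ z))))
      where x₀ = fromℕ< d≥1

  module _ {g : Labelling R} (L : Layered g) where

    P-of-label : ∀ u → g u ≤ p → ∃ λ a → u ≡ embP a
    P-of-label u le with block u
    ... | inP a e    = a , e
    ... | inD x refl = ⊥-elim (<⇒≱ (D-low L x) le)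
    ... | inQ z refl = ⊥-elim (<⇒≱ (≤-trans (s≤s (m≤m+n p d)) (Q-high L z)) le)

    D-of-label : ∀ u → p < g u → g u ≤ p + d → ∃ λ x → u ≡ embD x
    D-of-label u lo hi with block u
    ... | inP a refl = ⊥-elim (<⇒≱ lo (P-low L a))
    ... | inD x e    = x , e
    ... | inQ z refl = ⊥-elim (<⇒≱ (Q-high L z) hi)

    Q-of-label : ∀ u → p + d < g u → ∃ λ z → u ≡ embQ z
    Q-of-label u lo with block u
    ... | inP a refl = ⊥-elim (<⇒≱ (≤-trans (s≤s (m≤m+n p d)) lo) (P-low L a))
    ... | inD x refl = ⊥-elim (<⇒≱ lo (D-high L x))
    ... | inQ z e    = z , e

    P-boundary-blocked : 1 ≤ p → suc p ≤ N → Blocked R p g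
    P-boundary-blocked 1≤p p<N
      with onto L p 1≤p (<⇒≤ p<N) | onto L (suc p) (s≤s z≤n) p<N
    ... | u , gu≡p | v , gv≡1+p
      with P-of-label u (≤-reflexive gu≡p)
         | D-of-label v (≤-reflexive (sym gv≡1+p)) (subst (_≤ p + d) (sym gv≡1+p) p<p+d)
    ... | a , refl | x , refl = embP a , embD x , gu≡p , gv≡1+p , inj₁ (P≺DQ a (x ↑ˡ r))

    D-boundary-blocked : suc (p + d) ≤ N → Blocked R (p + d) g
    D-boundary-blocked p+d<N
      with onto L (p + d) (≤-trans (s≤s z≤n) p<p+d) (<⇒≤ p+d<N) | onto L (suc (p + d)) (s≤s z≤n) p+d<N
    ... | u , gu≡p+d | v , gv≡1+p+d
      with D-of-label u (subst (p <_) (sym gu≡p+d) p<p+d) (≤-reflexive gu≡p+d)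
         | Q-of-label v (≤-reflexive (sym gv≡1+p+d))
    ... | x , refl | z , refl = embD x , embQ z , gu≡p+d , gv≡1+p+d , inj₁ (D≺Q x z)

    free⇒≢p : ∀ {i} → 1 ≤ i → suc i ≤ N → ¬ Blocked R i g → i ≢ p
    free⇒≢p 1≤i i<N nb refl = nb (P-boundary-blocked 1≤i i<N)

    free⇒≢p+d : ∀ {i} → suc i ≤ N → ¬ Blocked R i g → i ≢ p + d
    free⇒≢p+d i<N nb refl = nb (D-boundary-blocked i<N)

  t-Layered : ∀ {g} i → Layered g → 1 ≤ i → suc i ≤ N → Layered (t R i g)
  t-Layered {g} i L 1≤i i<N = t-elim R Layered i g (λ _ → L) λ nb → record
    { P-low  = λ a → swapLab-≤ (P-low L a) (free⇒≢p L 1≤i i<N nb)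
    ; D-low  = λ x → <-swapLab (D-low L x) (free⇒≢p L 1≤i i<N nb)
    ; D-high = λ x → swapLab-≤ (D-high L x) (free⇒≢p+d L i<N nb)
    ; Q-high = λ z → <-swapLab (Q-high L z) (free⇒≢p+d L i<N nb)
    ; onto   = λ j 1≤j j≤N →
        let (u , gu) = onto L (swapLab i j) (<-swapLab 1≤j (λ i≡0 → <-irrefl (sym i≡0) 1≤i))
                                            (swapLab-≤ j≤N (λ i≡N → <-irrefl i≡N i<N))
        in u , trans (cong (swapLab i) gu) (swapLab-involutive i j)
    }

  tDown-Layered : ∀ {g} j → Layered g → j < N → Layered (tDown R j g)
  tDown-Layered zero    L _   = L
  tDown-Layered (suc j) L j<N = t-Layered (suc j) (tDown-Layered j L (<⇒≤ j<N)) (s≤s z≤n) j<N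

  module _ {g : Labelling R} (L : Layered g) {i : ℕ} where

    blocked-restrict : p < i → suc i ≤ p + d → Blocked R i g → Blocked D (i ∸ p) (IR g)
    blocked-restrict p<i i<p+d (u , v , gu≡i , gv≡1+i , c)
      with D-of-label L u (subst (p <_) (sym gu≡i) p<i) (subst (_≤ p + d) (sym gu≡i) (<⇒≤ i<p+d))
         | D-of-label L v (subst (p <_) (sym gv≡1+i) (m≤n⇒m≤1+n p<i)) (subst (_≤ p + d) (sym gv≡1+i) i<p+d)
    ... | x , refl | y , refl =
      x , y , cong (_∸ p) gu≡i , trans (cong (_∸ p) gv≡1+i) (+-∸-assoc 1 (<⇒≤ p<i)) ,
      subst id (embD-comparable x y) c

    blocked-extend : p ≤ i → Blocked D (i ∸ p) (IR g) → Blocked R i g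
    blocked-extend p≤i (x , y , gx∸p≡i∸p , gy∸p≡1+i∸p , c) =
      embD x , embD y ,
      ∸-cancelʳ-≡ (<⇒≤ (D-low L x)) p≤i gx∸p≡i∸p ,
      ∸-cancelʳ-≡ (<⇒≤ (D-low L y)) (m≤n⇒m≤1+n p≤i) (trans gy∸p≡1+i∸p (sym (+-∸-assoc 1 p≤i))) ,
      subst id (sym (embD-comparable x y)) c

    I-t-inside : p < i → suc i ≤ p + d → IR (t R i g) ≗ t D (i ∸ p) (IR g)
    I-t-inside p<i i<p+d x = t-elim R (λ h → IR h x ≡ t D (i ∸ p) (IR g) x) i g
      (λ b → sym (cong-app (t-blocked D (i ∸ p) (IR g) (blocked-restrict p<i i<p+d b)) x))
      (λ nb → trans (swapLab-∸ (<⇒≤ p<i) (<⇒≤ (D-low L x)))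
                    (sym (cong-app (t-unblocked D (i ∸ p) (IR g) (nb ∘ blocked-extend (<⇒≤ p<i))) x)))

    I-t-outside : 1 ≤ i → suc i ≤ N → i ≤ p ⊎ p + d ≤ i → IR (t R i g) ≗ IR g
    I-t-outside 1≤i i<N outside x = t-elim R (λ h → IR h x ≡ IR g x) i g (λ _ → refl)
      (λ nb → cong (_∸ p) (swapLab-other i (g (embD x)) (≢i nb) (≢1+i nb)))
      where
      ≢i : ¬ Blocked R i g → g (embD x) ≢ i
      ≢i nb gx≡i = [ (λ i≤p → <⇒≱ (D-low L x) (subst (_≤ p) (sym gx≡i) i≤p))
                   , (λ p+d≤i → free⇒≢p+d L i<N nb (≤-antisym (subst (_≤ p + d) gx≡i (D-high L x)) p+d≤i))
                   ] outside
      ≢1+i : ¬ Blocked R i g → g (embD x) ≢ suc i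
      ≢1+i nb gx≡1+i =
                   [ (λ i≤p → <⇒≱ (D-low L x)
                                  (subst (_≤ p) (sym gx≡1+i) (≤∧≢⇒< i≤p (free⇒≢p L 1≤i i<N nb))))
                       , (λ p+d≤i → <⇒≱ (s≤s p+d≤i) (subst (_≤ p + d) gx≡1+i (D-high L x)))
                       ] outside

  clip : ℕ → ℕ
  clip j = (j ∸ p) ⊓ (d ∸ 1)

  [p+d∸1]∸p≡d∸1 : p + d ∸ 1 ∸ p ≡ d ∸ 1
  [p+d∸1]∸p≡d∸1 = trans (cong (_∸ p) (+-∸-assoc p d≥1)) (m+n∸m≡n p (d ∸ 1))

  clip-≤p : ∀ {j} → j ≤ p → clip j ≡ 0
  clip-≤p j≤p = cong (_⊓ (d ∸ 1)) (m≤n⇒m∸n≡0 j≤p)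

  clip-inside : ∀ {j} → j < p + d → clip j ≡ j ∸ p
  clip-inside {j} j<p+d =
    m≤n⇒m⊓n≡m (subst (j ∸ p ≤_) [p+d∸1]∸p≡d∸1 (∸-monoˡ-≤ p (∸-monoˡ-≤ 1 j<p+d)))

  clip-top : ∀ {j} → p + d ∸ 1 ≤ j → clip j ≡ d ∸ 1
  clip-top {j} p+d∸1≤j = m≥n⇒m⊓n≡n (subst (_≤ j ∸ p) [p+d∸1]∸p≡d∸1 (∸-monoˡ-≤ p p+d∸1≤j))

  data ClipStep (j : ℕ) : Set where
    idle   : suc j ≤ p ⊎ p + d ≤ suc j → clip (suc j) ≡ clip j → ClipStep j
    active : p < suc j → suc (suc j) ≤ p + d → suc j ∸ p ≡ suc (clip j) → clip (suc j) ≡ suc (clip j) →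
             ClipStep j

  clipStep : ∀ j → ClipStep j
  clipStep j with suc j ≤? p | p + d ≤? suc j
  ... | yes 1+j≤p | _ = idle (inj₁ 1+j≤p) (trans (clip-≤p 1+j≤p) (sym (clip-≤p (<⇒≤ 1+j≤p))))
  ... | no _ | yes p+d≤1+j =
    idle (inj₂ p+d≤1+j) (trans (clip-top (m≤n⇒m≤1+n p+d∸1≤j)) (sym (clip-top p+d∸1≤j)))
    where p+d∸1≤j = ∸-monoˡ-≤ 1 p+d≤1+j
  ... | no 1+j≰p | no p+d≰1+j = active p<1+j 2+j≤p+d 1+j∸p≡1+clip (trans (clip-inside 2+j≤p+d) 1+j∸p≡1+clip)
    where
    p<1+j = ≰⇒> 1+j≰p
    2+j≤p+d = ≰⇒> p+d≰1+j
    1+j∸p≡1+clip : suc j ∸ p ≡ suc (clip j)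
    1+j∸p≡1+clip = trans (+-∸-assoc 1 (s≤s⁻¹ p<1+j)) (cong suc (sym (clip-inside (<⇒≤ 2+j≤p+d))))

  I-tDown : ∀ {g} j → Layered g → j < N → IR (tDown R j g) ≗ tDown D (clip j) (IR g)
  I-tDown {g} zero L _ x = cong (λ k → tDown D k (IR g) x) (sym (clip-≤p z≤n))
  I-tDown {g} (suc j) L j<N x with clipStep j
  ... | idle outside clip-same = begin
    IR (t R (suc j) h) x          ≡⟨ I-t-outside Lh (s≤s z≤n) j<N outside x ⟩
    IR h x                        ≡⟨ I-tDown j L (<⇒≤ j<N) x ⟩
    tDown D (clip j) (IR g) x     ≡⟨ cong (λ k → tDown D k (IR g) x) (sym clip-same) ⟩
    tDown D (clip (suc j)) (IR g) x ∎
    where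
    open ≡-Reasoning
    h = tDown R j g
    Lh = tDown-Layered j L (<⇒≤ j<N)
  ... | active p<1+j 2+j≤p+d 1+j∸p≡1+clip clip-suc = begin
    IR (t R (suc j) h) x                               ≡⟨ I-t-inside Lh p<1+j 2+j≤p+d x ⟩
    t D (suc j ∸ p) (IR h) x                           ≡⟨ t-cong D (suc j ∸ p) (I-tDown j L (<⇒≤ j<N)) x ⟩
    t D (suc j ∸ p) (tDown D (clip j) (IR g)) x        ≡⟨ cong (λ k → t D k (tDown D (clip j) (IR g)) x) 1+j∸p≡1+clip ⟩
    tDown D (suc (clip j)) (IR g) x                    ≡⟨ cong (λ k → tDown D k (IR g) x) (sym clip-suc) ⟩
    tDown D (clip (suc j)) (IR g) x ∎
    where
    open ≡-Reasoning
    h = tDown R j g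
    Lh = tDown-Layered j L (<⇒≤ j<N)

  qInduced : ℕ → Labelling D → Labelling D
  qInduced zero    h = h
  qInduced (suc m) h = qInduced m (tDown D (clip (suc m)) h)

  qInduced-cong : ∀ m {h h′} → h ≗ h′ → qInduced m h ≗ qInduced m h′
  qInduced-cong zero    h≗h′ = h≗h′
  qInduced-cong (suc m) h≗h′ = qInduced-cong m (tDown-cong D (clip (suc m)) h≗h′)

  I-q : ∀ {g} m → Layered g → m < N → IR (q R m g) ≗ qInduced m (IR g)
  I-q zero    L _   x = refl
  I-q {g} (suc m) L m<N x =
    trans (I-q m (tDown-Layered (suc m) L m<N) (<⇒≤ m<N) x)
          (qInduced-cong m (I-tDown (suc m) L m<N) x)

  qInduced-inside : ∀ m h → m < p + d → qInduced m h ≡ q D (m ∸ p) h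
  qInduced-inside zero    h _ = cong (λ k → q D k h) (sym (0∸n≡0 p))
  qInduced-inside (suc m) h 1+m<p+d with suc m ≤? p
  ... | yes 1+m≤p = begin
    qInduced m (tDown D (clip (suc m)) h)  ≡⟨ cong (λ k → qInduced m (tDown D k h)) (clip-≤p 1+m≤p) ⟩
    qInduced m h                           ≡⟨ qInduced-inside m h (<⇒≤ 1+m<p+d) ⟩
    q D (m ∸ p) h                          ≡⟨ cong (λ k → q D k h) (trans (m≤n⇒m∸n≡0 (<⇒≤ 1+m≤p)) (sym (m≤n⇒m∸n≡0 1+m≤p))) ⟩
    q D (suc m ∸ p) h ∎
    where open ≡-Reasoning
  ... | no 1+m≰p = begin
    qInduced m (tDown D (clip (suc m)) h)  ≡⟨ cong (λ k → qInduced m (tDown D k h)) (trans (clip-inside 1+m<p+d) 1+m∸p) ⟩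
    qInduced m (tDown D (suc (m ∸ p)) h)   ≡⟨ qInduced-inside m _ (<⇒≤ 1+m<p+d) ⟩
    q D (suc (m ∸ p)) h                    ≡⟨ cong (λ k → q D k h) (sym 1+m∸p) ⟩
    q D (suc m ∸ p) h ∎
    where
    open ≡-Reasoning
    1+m∸p : suc m ∸ p ≡ suc (m ∸ p)
    1+m∸p = +-∸-assoc 1 (s≤s⁻¹ (≰⇒> 1+m≰p))

  qInduced-top : ∀ e h → qInduced (e + (p + d ∸ 1)) h ≡ q D (d ∸ 1) (iter e (tDown D (d ∸ 1)) h)
  qInduced-top zero h =
    trans (qInduced-inside (p + d ∸ 1) h (∸-monoʳ-< {o = 0} (s≤s z≤n) (≤-trans d≥1 (m≤n+m d p))))
          (cong (λ k → q D k h) [p+d∸1]∸p≡d∸1)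
  qInduced-top (suc e) h = begin
    qInduced (e + (p + d ∸ 1)) (tDown D (clip (suc (e + (p + d ∸ 1)))) h)
      ≡⟨ cong (λ k → qInduced (e + (p + d ∸ 1)) (tDown D k h)) (clip-top (m≤n⇒m≤1+n (m≤n+m _ e))) ⟩
    qInduced (e + (p + d ∸ 1)) (tDown D (d ∸ 1) h)
      ≡⟨ qInduced-top e (tDown D (d ∸ 1) h) ⟩
    q D (d ∸ 1) (iter e (tDown D (d ∸ 1)) (tDown D (d ∸ 1) h))
      ≡⟨ cong (q D (d ∸ 1)) (iter-comm e (tDown D (d ∸ 1)) h) ⟩
    q D (d ∸ 1) (iter (suc e) (tDown D (d ∸ 1)) h) ∎
    where open ≡-Reasoning

  module _ (f : LinExt R) where

    I-q-below : ∀ m → m ≤ p → IR (q R m (lab f)) ≗ IR (lab f)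
    I-q-below m m≤p x = begin
      IR (q R m (lab f)) x              ≡⟨ I-q m (linExt-Layered f) (<-≤-trans m<p+d p+d≤N) x ⟩
      qInduced m (IR (lab f)) x         ≡⟨ cong-app (qInduced-inside m (IR (lab f)) m<p+d) x ⟩
      q D (m ∸ p) (IR (lab f)) x        ≡⟨ cong (λ k → q D k (IR (lab f)) x) (m≤n⇒m∸n≡0 m≤p) ⟩
      IR (lab f) x ∎
      where
      open ≡-Reasoning
      m<p+d = ≤-<-trans m≤p p<p+d

    I-q-inside : ∀ m → m < p + d → IR (q R m (lab f)) ≗ q D (m ∸ p) (IR (lab f))
    I-q-inside m m<p+d x =
      trans (I-q m (linExt-Layered f) (<-≤-trans m<p+d p+d≤N) x)
            (cong-app (qInduced-inside m (IR (lab f)) m<p+d) x)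

    I-q-above : ∀ m → p + d ≤ m → m < N →
                IR (q R m (lab f)) ≗ q D (d ∸ 1) (iter (suc m ∸ p ∸ d) (∂ D d) (IR (lab f)))
    I-q-above m p+d≤m m<N x = begin
      IR (q R m (lab f)) x            ≡⟨ I-q m (linExt-Layered f) m<N x ⟩
      qInduced m (IR (lab f)) x       ≡⟨ cong (λ k → qInduced k (IR (lab f)) x) (sym m-split) ⟩
      qInduced (e + (p + d ∸ 1)) (IR (lab f)) x ≡⟨ cong-app (qInduced-top e (IR (lab f))) x ⟩
      q D (d ∸ 1) (iter e (∂ D d) (IR (lab f))) x ∎
      where
      open ≡-Reasoning
      e = suc m ∸ p ∸ d
      m-split : e + (p + d ∸ 1) ≡ m
      m-split = begin
        suc m ∸ p ∸ d + (p + d ∸ 1)       ≡⟨ cong (_+ (p + d ∸ 1)) (∸-+-assoc (suc m) p d) ⟩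
        suc m ∸ (p + d) + (p + d ∸ 1)     ≡⟨ cong (_+ (p + d ∸ 1)) (+-∸-assoc 1 p+d≤m) ⟩
        suc (m ∸ (p + d)) + (p + d ∸ 1)   ≡⟨ sym (+-suc (m ∸ (p + d)) (p + d ∸ 1)) ⟩
        m ∸ (p + d) + suc (p + d ∸ 1)     ≡⟨ cong (m ∸ (p + d) +_) (sym (+-∸-assoc 1 (≤-trans (s≤s z≤n) p<p+d))) ⟩
        m ∸ (p + d) + (p + d)             ≡⟨ m∸n+n≡m p+d≤m ⟩
        m ∎

size-Dλ : ∀ λs → size (Dλ λs) ≡ sum λs
size-Dλ []       = refl
size-Dλ (m ∷ λs) = cong (m +_) (size-Dλ λs)

InFrakD⇒size≡ : ∀ {n λs} → InFrakD n λs → size (Dλ λs) ≡ n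
InFrakD⇒size≡ {λs = λs} (inj₁ (_ , (_ , _ , sum≡n) , _)) = trans (size-Dλ λs) sum≡n
InFrakD⇒size≡ (inj₂ (refl , refl)) = refl

InFrakD⇒1≤n : ∀ {n λs} → InFrakD n λs → 1 ≤ n
InFrakD⇒1≤n (inj₁ (1<n , _))   = <⇒≤ 1<n
InFrakD⇒1≤n (inj₂ (refl , _)) = s≤s z≤n

lemma4p4 : (P Q : FinPoset) (n : ℕ) (λs : List ℕ) → InFrakD n λs →
           (f : LinExt (P ⊕ (Dλ λs ⊕ Q))) (k : ℕ) →
           1 ≤ k → k ≤ size P + n + size Q →
           (k ∸ 1 ≤ size P →
             I P (Dλ λs) Q (q (P ⊕ (Dλ λs ⊕ Q)) (k ∸ 1) (lab f))
               ≗ I P (Dλ λs) Q (lab f))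
           × (size P < k ∸ 1 → k ∸ 1 < size P + n →
             I P (Dλ λs) Q (q (P ⊕ (Dλ λs ⊕ Q)) (k ∸ 1) (lab f))
               ≗ q (Dλ λs) (k ∸ 1 ∸ size P) (I P (Dλ λs) Q (lab f)))
           × (size P + n ≤ k ∸ 1 →
             I P (Dλ λs) Q (q (P ⊕ (Dλ λs ⊕ Q)) (k ∸ 1) (lab f))
               ≗ q (Dλ λs) (n ∸ 1) (iter (k ∸ size P ∸ n) (∂ (Dλ λs) n) (I P (Dλ λs) Q (lab f))))
lemma4p4 P Q n λs D∈𝔇n f (suc m) _ k≤N rewrite sym (InFrakD⇒size≡ D∈𝔇n) =
  I-q-below f m , (λ _ → I-q-inside f m) , (λ p+d≤m → I-q-above f m p+d≤m m<N)
  where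
  open OrdinalSum P (Dλ λs) Q (subst (1 ≤_) (sym (InFrakD⇒size≡ D∈𝔇n)) (InFrakD⇒1≤n D∈𝔇n))
  m<N : m < N
  m<N = subst (m <_) (+-assoc p d r) k≤N
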